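{- Let $\Gamma$ be a simple connected graph with $\operatorname{diam}(\Gamma)\geq 4$, and let $A(\Gamma)$ be its adjacency matrix. Then there exists a non-zero $(0,1)$-vector in the row space of $A(\Gamma)$ over $\mathbb{R}$ which does not occur as a row of $A(\Gamma)$.
   Context: For a simple graph with vertices $v_1,\dots,v_n$, the adjacency matrix $A(\Gamma)=(a_{ij})$ has $a_{ij}=1$ if $v_i$ is adjacent to $v_j$ and $a_{ij}=0$ otherwise. The row space is taken over the real numbers. $\operatorname{diam}(\Gamma)$ is the maximum distance between two vertices. -}

module Defs where

open import Data.Nat using (ℕ; zero; suc; _<_)
open import Data.Fin using (Fin; zero; suc)
open import Data.Bool using (Bool; true; false; if_then_else_)
open import Data.Rational using (ℚ; 0ℚ; 1ℚ; _+_; _*_)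
open import Data.Product using (Σ; ∃; ∃-syntax; Σ-syntax; _×_; _,_)
open import Relation.Binary.PropositionalEquality using (_≡_)
open import Relation.Nullary using (¬_)

record SimpleGraph (n : ℕ) : Set where
  field
    adj       : Fin n → Fin n → Bool
    symmetric : ∀ i j → adj i j ≡ adj j i
    loopless  : ∀ i → adj i i ≡ false

open SimpleGraph public

data Walk {n : ℕ} (G : SimpleGraph n) : Fin n → Fin n → ℕ → Set where
  here : ∀ u → Walk G u u zero
  step : ∀ {u w v k} → adj G u w ≡ true → Walk G w v k → Walk G u v (suc k)

Connected : ∀ {n} → SimpleGraph n → Set
Connected G = ∀ u v → ∃[ k ] Walk G u v k

-- diam(Γ) ≥ d : some pair of vertices is at distance ≥ d,
-- i.e. not joined by any walk of length < d.
DiamGe : ∀ {n} → SimpleGraph n → ℕ → Set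
DiamGe G d = ∃[ u ] ∃[ v ] (∀ m → m < d → ¬ Walk G u v m)

toℚ : Bool → ℚ
toℚ b = if b then 1ℚ else 0ℚ

sumℚ : ∀ {n} → (Fin n → ℚ) → ℚ
sumℚ {zero} f = 0ℚ
sumℚ {suc n} f = f zero + sumℚ (λ i → f (suc i))

InRowSpace : ∀ {n} → SimpleGraph n → (Fin n → ℚ) → Set
InRowSpace {n} G x = Σ[ c ∈ (Fin n → ℚ) ] (∀ j → sumℚ (λ i → c i * toℚ (adj G i j)) ≡ x j)

IsRow : ∀ {n} → SimpleGraph n → (Fin n → Bool) → Set
IsRow G x = ∃[ i ] (∀ j → adj G i j ≡ x j)

{-# OPTIONS --safe #-}
module Submission where

-- Let u, v be at distance at least 4, let a be a neighbour of u and c a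
-- neighbour of v.  The rows of u and c have disjoint supports (a common
-- neighbour j would give the walk u j c v of length 3), so their sum x is
-- a nonzero 0/1-vector of the row space.  If x were the row of a vertex w,
-- then w would be adjacent to a (in the support of row u) and to v (in the
-- support of row c), giving the walk u a w v of length 3.

open import Defs
open import Data.Nat using (ℕ; zero; suc; s≤s; z≤n)
open import Data.Fin using (Fin; zero; suc)
open import Data.Fin.Properties using (_≟_)
open import Data.Bool using (Bool; true; false; _∧_; _∨_)
open import Data.Bool.Properties using (∨-zeroʳ)
open import Data.Product using (∃-syntax; Σ-syntax; _×_; _,_)
open import Data.Rational using (ℚ; 0ℚ; 1ℚ; _+_; _*_)
open import Data.Rational.Properties
  using (+-0-commutativeMonoid; +-identityˡ; +-identityʳ; *-zeroˡ; *-identityˡ; *-distribʳ-+)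
open import Function using (_∘_)
open import Relation.Binary.PropositionalEquality
  using (_≡_; _≢_; _≗_; refl; sym; trans; cong; cong₂; ≢-sym; module ≡-Reasoning)
open import Relation.Nullary using (¬_; does; contradiction)
open import Algebra.Properties.CommutativeMonoid.Sum +-0-commutativeMonoid
  using (sum; ∑-distrib-+; sum-cong-≗; sum-replicate-zero)

open ≡-Reasoning

private
  variable
    n : ℕ

sumℚ≡sum : (f : Fin n → ℚ) → sumℚ f ≡ sum f
sumℚ≡sum {zero}  f = refl
sumℚ≡sum {suc n} f = cong (f zero +_) (sumℚ≡sum (f ∘ suc))

sumℚ-cong : {f g : Fin n → ℚ} → f ≗ g → sumℚ f ≡ sumℚ g
sumℚ-cong {f = f} {g} f≗g = begin
  sumℚ f ≡⟨ sumℚ≡sum f ⟩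
  sum f  ≡⟨ sum-cong-≗ f≗g ⟩
  sum g  ≡⟨ sumℚ≡sum g ⟨
  sumℚ g ∎

sumℚ-distrib-+ : (f g : Fin n → ℚ) → sumℚ (λ i → f i + g i) ≡ sumℚ f + sumℚ g
sumℚ-distrib-+ f g = begin
  sumℚ (λ i → f i + g i) ≡⟨ sumℚ≡sum (λ i → f i + g i) ⟩
  sum (λ i → f i + g i)  ≡⟨ ∑-distrib-+ f g ⟩
  sum f + sum g          ≡⟨ cong₂ _+_ (sumℚ≡sum f) (sumℚ≡sum g) ⟨
  sumℚ f + sumℚ g        ∎

sumℚ-zero : {f : Fin n → ℚ} → (∀ i → f i ≡ 0ℚ) → sumℚ f ≡ 0ℚ
sumℚ-zero {n} f≡0 = trans (sumℚ-cong f≡0) (trans (sumℚ≡sum {n} (λ _ → 0ℚ)) (sum-replicate-zero n))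

δ : Fin n → Fin n → ℚ
δ u i = toℚ (does (i ≟ u))

sumℚ-δ : (u : Fin n) (h : Fin n → ℚ) → sumℚ (λ i → δ u i * h i) ≡ h u
sumℚ-δ zero h = begin
  1ℚ * h zero + sumℚ (λ i → 0ℚ * h (suc i)) ≡⟨ cong₂ _+_ (*-identityˡ (h zero)) (sumℚ-zero (*-zeroˡ ∘ h ∘ suc)) ⟩
  h zero + 0ℚ                               ≡⟨ +-identityʳ (h zero) ⟩
  h zero                                    ∎
sumℚ-δ (suc u) h = begin
  0ℚ * h zero + sumℚ (λ i → δ u i * h (suc i)) ≡⟨ cong₂ _+_ (*-zeroˡ (h zero)) (sumℚ-δ u (h ∘ suc)) ⟩
  0ℚ + h (suc u)                               ≡⟨ +-identityˡ (h (suc u)) ⟩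
  h (suc u)                                    ∎

module _ (G : SimpleGraph n) where

  row∈rowSpace : (u : Fin n) → InRowSpace G (toℚ ∘ adj G u)
  row∈rowSpace u = δ u , λ j → sumℚ-δ u (λ i → toℚ (adj G i j))

  rowSpace-+ : {x y : Fin n → ℚ} → InRowSpace G x → InRowSpace G y →
               InRowSpace G (λ j → x j + y j)
  rowSpace-+ {x} {y} (c , cA≡x) (d , dA≡y) = (λ i → c i + d i) , λ j → begin
    sumℚ (λ i → (c i + d i) * A i j)                    ≡⟨ sumℚ-cong (λ i → *-distribʳ-+ (A i j) (c i) (d i)) ⟩
    sumℚ (λ i → c i * A i j + d i * A i j)              ≡⟨ sumℚ-distrib-+ (λ i → c i * A i j) (λ i → d i * A i j) ⟩
    sumℚ (λ i → c i * A i j) + sumℚ (λ i → d i * A i j) ≡⟨ cong₂ _+_ (cA≡x j) (dA≡y j) ⟩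
    x j + y j                                           ∎
    where
    A : Fin n → Fin n → ℚ
    A i j = toℚ (adj G i j)

  rowSpace-≗ : {x y : Fin n → ℚ} → x ≗ y → InRowSpace G x → InRowSpace G y
  rowSpace-≗ x≗y (c , cA≡x) = c , λ j → trans (cA≡x j) (x≗y j)

toℚ-∨ : ∀ a b → a ∧ b ≡ false → toℚ (a ∨ b) ≡ toℚ a + toℚ b
toℚ-∨ true  false _ = sym (+-identityʳ 1ℚ)
toℚ-∨ false true  _ = sym (+-identityˡ 1ℚ)
toℚ-∨ false false _ = sym (+-identityˡ 0ℚ)

module _ {G : SimpleGraph n} where

  walk₃ : ∀ {u a b v} → adj G u a ≡ true → adj G a b ≡ true → adj G b v ≡ true → Walk G u v 3
  walk₃ ua ab bv = step ua (step ab (step bv (here _)))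

  connected⇒neighbour : Connected G → ∀ {u v} → u ≢ v → ∃[ a ] adj G u a ≡ true
  connected⇒neighbour conn {u} {v} u≢v with conn u v
  ... | zero  , here _            = contradiction refl u≢v
  ... | suc _ , step {w = a} ua _ = a , ua

  module _ {u v c : Fin n} (no-walk₃ : ¬ Walk G u v 3) (cv : adj G c v ≡ true) where

    disjoint-rows : ∀ j → adj G u j ∧ adj G c j ≡ false
    disjoint-rows j with adj G u j in uj | adj G c j in cj
    ... | true  | true  = contradiction (walk₃ uj (trans (symmetric G j c) cj) cv) no-walk₃
    ... | true  | false = refl
    ... | false | _     = refl

    rows-∨∈rowSpace : InRowSpace G (λ j → toℚ (adj G u j ∨ adj G c j))
    rows-∨∈rowSpace =
      rowSpace-≗ G (λ j → sym (toℚ-∨ (adj G u j) (adj G c j) (disjoint-rows j)))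
                 (rowSpace-+ G (row∈rowSpace G u) (row∈rowSpace G c))

    rows-∨-not-row : ∀ {a} → adj G u a ≡ true → ¬ IsRow G (λ j → adj G u j ∨ adj G c j)
    rows-∨-not-row {a} ua (w , w-row) = no-walk₃ (walk₃ ua aw wv)
      where
      aw : adj G a w ≡ true
      aw = begin
        adj G a w             ≡⟨ symmetric G a w ⟩
        adj G w a             ≡⟨ w-row a ⟩
        adj G u a ∨ adj G c a ≡⟨ cong (_∨ adj G c a) ua ⟩
        true                  ∎
      wv : adj G w v ≡ true
      wv = begin
        adj G w v             ≡⟨ w-row v ⟩
        adj G u v ∨ adj G c v ≡⟨ cong (adj G u v ∨_) cv ⟩
        adj G u v ∨ true      ≡⟨ ∨-zeroʳ _ ⟩
        true                  ∎

theorem3p1 : ∀ {n : ℕ} (G : SimpleGraph n) → Connected G → DiamGe G 4 →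
    Σ[ x ∈ (Fin n → Bool) ] ((∃[ j ] (x j ≡ true)) × InRowSpace G (λ j → toℚ (x j)) × ¬ IsRow G x)
theorem3p1 G conn (u , v , far) =
  let a , ua = connected⇒neighbour conn u≢v
      c , vc = connected⇒neighbour conn (≢-sym u≢v)
      cv     = trans (symmetric G c v) vc
  in (λ j → adj G u j ∨ adj G c j)
     , (a , cong (_∨ adj G c a) ua)
     , rows-∨∈rowSpace no-walk₃ cv
     , rows-∨-not-row no-walk₃ cv ua
  where
  no-walk₃ : ¬ Walk G u v 3
  no-walk₃ = far 3 (s≤s (s≤s (s≤s (s≤s z≤n))))
  u≢v : u ≢ v
  u≢v refl = far 0 (s≤s z≤n) (here u)
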